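{- Let $G$ be an unweighted multigraph and let $T$ be a spanning tree of $G$ rooted at $r$ that is an edge-disjoint union of maximal branches meeting only at $r$. Let $S^*_1,\ldots,S^*_k$ be a minimum $k$-cut of $G$ such that $E_T[S^*_1,\ldots,S^*_k]$ consists of exactly $k-1$ edges, at most one from each maximal branch, with $r\in S^*_k$, and let $v^*_1,\ldots,v^*_{k-1}$ be the child vertices of these $k-1$ edges, so that $S^*_i=V(T(v^*_i))$ for $i\in[k-1]$. Let $E'$ be the set of edges of $G$ whose two endpoints do not lie on a common branch of $T$. Let $H$ be the multigraph with vertex set $\{v^*_1,\ldots,v^*_{k-1}\}$ having, for each edge $e\in E'$ with one endpoint in $T(v^*_i)$ and the other in $T(v^*_j)$ ($i\ne j$), an edge $e$ between $v^*_i$ and $v^*_j$. Then for each connected component $C$ of $H$ there is a spanning tree $T_C$ of $C$ with the following property: letting $U$ be the set of endpoints in $G$ of the edges of $T_C$, every edge $e$ of $C$ is partially preceded (in $T$) by some vertex of $U$.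
   Context: In a rooted tree $T$, $T(v)$ is the subtree rooted at $v$; a branch is a path whose vertices have distinct depths; a maximal branch goes from the root to a leaf. A vertex $x$ precedes $y$ if $y\in T(x)$ (so $x$ precedes itself). For an edge $(u,v)$ of $T$ with $v$ a child of $u$, $v$ is its child vertex. An edge $e$ of $G$ with endpoints $a,b$ is partially preceded by a vertex $x$ if $x$ precedes $a$ or $x$ precedes $b$. $E_T[S_1,\ldots,S_k]$ is the set of edges of $T$ with endpoints in distinct parts. A minimum $k$-cut is a partition of $V(G)$ into $k$ nonempty parts minimizing the number of edges of $G$ between distinct parts. Each edge of $H$ is identified with the edge of $G$ it comes from, and its endpoints in $G$ are the original endpoints of that edge. -}

module Defs where

open import Data.Nat using (ℕ; zero; suc; _+_; _≤_)
open import Data.Fin using (Fin; inject₁; fromℕ)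
open import Data.Fin.Properties using (_≟_)
open import Data.Bool using (Bool; true; false; if_then_else_; not)
open import Data.Product using (Σ; ∃; ∃-syntax; _×_; _,_)
open import Data.Sum using (_⊎_)
open import Data.Unit using (⊤)
open import Data.List using (List)
open import Data.List.Membership.Propositional using (_∈_)
open import Relation.Binary.PropositionalEquality using (_≡_; _≢_)
open import Relation.Nullary using (¬_)
open import Relation.Nullary.Decidable using (⌊_⌋)
open import Function.Bundles using (_⇔_)

record Multigraph : Set where
  field
    nV nE : ℕ
    end₁ end₂ : Fin nE → Fin nV

-- Rooted trees on Fin n given by a root and a parent map.
-- Precedes r parent x y : x precedes y, i.e. y ∈ T(x) (reflexive).

data Precedes {n : ℕ} (r : Fin n) (parent : Fin n → Fin n) (x : Fin n)
     : Fin n → Set where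
  here : Precedes r parent x x
  up   : ∀ {y} → y ≢ r → Precedes r parent x (parent y) → Precedes r parent x y

-- A spanning tree of G rooted at root: every vertex lies below the root
-- (so the parent map is acyclic), and each tree edge {v, parent v}
-- (v non-root, v its child vertex) is a distinct edge of G.
record RootedSpanningTree (G : Multigraph) : Set where
  open Multigraph G
  field
    root      : Fin nV
    parent    : Fin nV → Fin nV
    reaches   : ∀ v → Precedes root parent root v
    treeEdge  : (v : Fin nV) → v ≢ root → Fin nE
    treeEdge-ends : ∀ v (p : v ≢ root) →
      (end₁ (treeEdge v p) ≡ v × end₂ (treeEdge v p) ≡ parent v) ⊎
      (end₁ (treeEdge v p) ≡ parent v × end₂ (treeEdge v p) ≡ v)
    treeEdge-inj : ∀ v w (p : v ≢ root) (q : w ≢ root) →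
      treeEdge v p ≡ treeEdge w q → v ≡ w

module TreeNotions {G : Multigraph} (T : RootedSpanningTree G) where
  open Multigraph G
  open RootedSpanningTree T

  _≼_ : Fin nV → Fin nV → Set
  x ≼ y = Precedes root parent x y

  Leaf : Fin nV → Set
  Leaf ℓ = ∀ w → w ≢ root → parent w ≢ ℓ

  OnMaxBranch : Fin nV → Fin nV → Set
  OnMaxBranch ℓ x = Leaf ℓ × x ≼ ℓ

  IsUnionOfBranchesAtRoot : Set
  IsUnionOfBranchesAtRoot = ∀ ℓ₁ ℓ₂ → Leaf ℓ₁ → Leaf ℓ₂ → ℓ₁ ≢ ℓ₂ →
    ∀ x → x ≼ ℓ₁ → x ≼ ℓ₂ → x ≡ root

  -- A branch is a vertical path from top down to bot (distinct depths);
  -- x lies on it iff top ≼ x ≼ bot.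
  OnCommonBranch : Fin nV → Fin nV → Set
  OnCommonBranch a b = ∃[ top ] ∃[ bot ]
    (top ≼ bot × (top ≼ a × a ≼ bot) × (top ≼ b × b ≼ bot))

  PartiallyPreceded : Fin nV → Fin nE → Set
  PartiallyPreceded x e = x ≼ end₁ e ⊎ x ≼ end₂ e

  InE' : Fin nE → Set
  InE' e = ¬ OnCommonBranch (end₁ e) (end₂ e)

count : ∀ {m} → (Fin m → Bool) → ℕ
count {zero}  f = 0
count {suc m} f = (if f Fin.zero then 1 else 0) + count (λ i → f (Fin.suc i))

module CutNotions (G : Multigraph) where
  open Multigraph G

  Surjective : ∀ {k} → (Fin nV → Fin k) → Set
  Surjective {k} part = ∀ (i : Fin k) → ∃[ v ] part v ≡ i

  cutSize : ∀ {k} → (Fin nV → Fin k) → ℕ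
  cutSize part = count (λ e → not ⌊ part (end₁ e) ≟ part (end₂ e) ⌋)

  IsMinKCut : (k : ℕ) → (Fin nV → Fin k) → Set
  IsMinKCut k part = Surjective part ×
    (∀ (part' : Fin nV → Fin k) → Surjective part' → cutSize part ≤ cutSize part')

module HNotions {G : Multigraph} (T : RootedSpanningTree G)
                {j : ℕ} (vs : Fin j → Fin (Multigraph.nV G)) where
  open Multigraph G
  open TreeNotions T

  HEdge : Fin nE → Fin j → Fin j → Set
  HEdge e i i' = InE' e × i ≢ i' × vs i ≼ end₁ e × vs i' ≼ end₂ e

  HAdj : Fin nE → Fin j → Fin j → Set
  HAdj e i i' = HEdge e i i' ⊎ HEdge e i' i

  data Conn (allowed : Fin nE → Set) : Fin j → Fin j → Set where
    stay : ∀ {i} → Conn allowed i i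
    step : ∀ {e i i' i''} → allowed e → HAdj e i i' → Conn allowed i' i'' →
           Conn allowed i i''

  InComp : Fin j → Fin j → Set
  InComp c i = Conn (λ _ → ⊤) c i

  CompEdge : Fin j → Fin nE → Set
  CompEdge c e = ∃[ i ] ∃[ i' ] (HAdj e i i' × InComp c i)

  -- TC (a list of edges of H) is a spanning tree of the component of c:
  -- its edges are edges of the component, it connects all vertices of the
  -- component, and it is minimally connected (acyclic): removing any of
  -- its edges disconnects that edge's endpoints.
  IsSpanningTreeOfComp : Fin j → List (Fin nE) → Set
  IsSpanningTreeOfComp c TC =
    (∀ e → e ∈ TC → CompEdge c e) ×
    (∀ i → InComp c i → Conn (_∈ TC) c i) ×
    (∀ e → e ∈ TC → ∀ i i' → HAdj e i i' →
       ¬ Conn (λ e' → e' ∈ TC × e' ≢ e) i i')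

  PrecededByEndpointOf : List (Fin nE) → Fin nE → Set
  PrecededByEndpointOf TC e = ∃[ e' ] (e' ∈ TC × ∃[ u ]
    ((u ≡ end₁ e' ⊎ u ≡ end₂ e') × PartiallyPreceded u e))

-- Build T_C greedily, Prim-style, from c: keep a set S of vertices of C spanned by the tree
-- built so far and repeatedly add an edge of H from S to a new vertex z whose endpoint in
-- T(v_z) is as shallow as possible. Since T is a union of branches meeting only at the root
-- and v_z is not the root, T(v_z) is a single path; so that endpoint precedes the endpoint in
-- T(v_z) of every other edge between S and z. When the growth stops, S is all of C, and every
-- edge of C is partially preceded by an endpoint of the tree edge that brought in whichever
-- of its two ends joined S last.
module Submission where

open import Defs
open import Data.Nat using (ℕ; zero; suc; _+_; _≤_; _<_; s≤s)
open import Data.Nat.Properties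
  using (≤-isTotalPreorder; ≤-reflexive; ≤-trans; m≤m+n; m≤n+m; <⇒≱; +-suc; +-monoʳ-≤)
open import Data.Fin using (Fin; inject₁; fromℕ)
open import Data.Fin.Properties using (_≟_; inject₁-injective)
open import Data.Fin.Subset using (Subset; ⁅_⁆; _∪_; ∣_∣) renaming (_∈_ to _∈ₛ_; _∉_ to _∉ₛ_)
open import Data.Fin.Subset.Properties
  using (_∈?_; ∈⊤; x∈⁅x⁆; x∈⁅y⁆⇒x≡y; x∈p∪q⁺; x∈p∪q⁻; p⊆p∪q; ⊆-max; ∣⊤∣≡n; p⊂q⇒∣p∣<∣q∣)
open import Data.Product using (∃; ∃-syntax; _×_; _,_; proj₁; proj₂)
open import Data.Sum using (_⊎_; inj₁; inj₂)
open import Data.Empty using (⊥-elim)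
open import Data.Unit using (tt)
open import Data.List using (List; []; _∷_; allFin; cartesianProduct)
open import Data.List.Relation.Unary.Any using (here; there)
open import Data.List.Membership.Propositional using (_∈_)
open import Data.List.Membership.Propositional.Properties using (∈-allFin; ∈-cartesianProduct⁺)
open import Level using (0ℓ)
open import Relation.Binary using (Rel; IsTotalPreorder)
import Relation.Binary.Construct.Flip.EqAndOrd as Flip
open import Relation.Binary.PropositionalEquality
  using (_≡_; _≢_; refl; sym; trans; cong; subst; subst₂)
open import Relation.Nullary using (¬_; Dec; yes; no)
open import Relation.Nullary.Decidable using (map′; ¬?; _×-dec_; _⊎-dec_; decidable-stable)
open import Relation.Unary using (Pred; Decidable)
open import Function using (_∘_)
open import Function.Bundles using (_⇔_; Equivalence)

module _ {A B : Set} {_≈_ _≲_ : Rel B 0ℓ} (≲-isTotalPreorder : IsTotalPreorder _≈_ _≲_)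
         (f : A → B) {P : Pred A 0ℓ} (P? : Decidable P) where
  open IsTotalPreorder ≲-isTotalPreorder using (total) renaming (refl to ≲-refl; trans to ≲-trans)

  least-or-none : (xs : List A) → (∀ {x} → x ∈ xs → ¬ P x) ⊎
                  ∃[ m ] (P m × ∀ {x} → x ∈ xs → P x → f m ≲ f x)
  least-or-none [] = inj₁ λ ()
  least-or-none (x ∷ xs) with least-or-none xs | P? x
  ... | inj₁ none | no ¬px = inj₁ λ { (here refl) → ¬px ; (there x∈) → none x∈ }
  ... | inj₁ none | yes px =
    inj₂ (x , px , λ { (here refl) _ → ≲-refl ; (there y∈) py → ⊥-elim (none y∈ py) })
  ... | inj₂ (m , pm , least) | no ¬px =
    inj₂ (m , pm , λ { (here refl) px → ⊥-elim (¬px px) ; (there y∈) → least y∈ })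
  ... | inj₂ (m , pm , least) | yes px with total (f x) (f m)
  ...   | inj₁ x≲m =
    inj₂ (x , px , λ { (here refl) _ → ≲-refl ; (there y∈) py → ≲-trans x≲m (least y∈ py) })
  ...   | inj₂ m≲x = inj₂ (m , pm , λ { (here refl) _ → m≲x ; (there y∈) → least y∈ })

module _ {n : ℕ} {p : Subset n} {x : Fin n} (x∉p : x ∉ₛ p) where

  x∉p⇒∣p∣<∣p∪⁅x⁆∣ : ∣ p ∣ < ∣ p ∪ ⁅ x ⁆ ∣
  x∉p⇒∣p∣<∣p∪⁅x⁆∣ = p⊂q⇒∣p∣<∣q∣ (p⊆p∪q ⁅ x ⁆ , x , x∈p∪q⁺ (inj₂ (x∈⁅x⁆ x)) , x∉p)

  x∉p⇒∣p∣<n : ∣ p ∣ < n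
  x∉p⇒∣p∣<n = subst (∣ p ∣ <_) (∣⊤∣≡n n) (p⊂q⇒∣p∣<∣q∣ (⊆-max p , x , ∈⊤ , x∉p))

module RootedSpanningTreeProperties {G : Multigraph} (T : RootedSpanningTree G) where
  open Multigraph G
  open RootedSpanningTree T
  open TreeNotions T

  ≼-trans : ∀ {x y z} → x ≼ y → y ≼ z → x ≼ z
  ≼-trans p here = p
  ≼-trans p (up y≢r q) = up y≢r (≼-trans p q)

  ≼-root : ∀ {x} → x ≼ root → x ≡ root
  ≼-root here = refl
  ≼-root (up r≢r _) = ⊥-elim (r≢r refl)

  ancestors-comparable : ∀ {x y z} → x ≼ z → y ≼ z → x ≼ y ⊎ y ≼ x
  ancestors-comparable here q = inj₂ q
  ancestors-comparable (up z≢r p) here = inj₁ (up z≢r p)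
  ancestors-comparable (up _ p) (up _ q) = ancestors-comparable p q

  ≼-dec : ∀ x y → Dec (x ≼ y)
  ≼-dec x y = below (reaches y)
    where
      below : ∀ {y} → root ≼ y → Dec (x ≼ y)
      below here = map′ (λ { refl → here }) ≼-root (x ≟ root)
      below {y} (up y≢r q) with x ≟ y | below q
      ... | yes refl | _ = yes here
      ... | no _ | yes p = yes (up y≢r p)
      ... | no x≢y | no ¬p = no λ { here → x≢y refl ; (up _ p) → ¬p p }

  length : ∀ {x y} → x ≼ y → ℕ
  length here = 0
  length (up _ p) = suc (length p)

  length-trans : ∀ {x y z} (p : x ≼ y) (q : y ≼ z) → length (≼-trans p q) ≡ length q + length p
  length-trans p here = refl
  length-trans p (up _ q) = cong suc (length-trans p q)

  length-from-root : ∀ {y} (p q : root ≼ y) → length p ≡ length q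
  length-from-root here here = refl
  length-from-root here (up r≢r _) = ⊥-elim (r≢r refl)
  length-from-root (up r≢r _) here = ⊥-elim (r≢r refl)
  length-from-root (up _ p) (up _ q) = cong suc (length-from-root p q)

  depth : Fin nV → ℕ
  depth v = length (reaches v)

  depth-≼ : ∀ {x y} (p : x ≼ y) → depth y ≡ length p + depth x
  depth-≼ {x} {y} p = trans (length-from-root (reaches y) (≼-trans (reaches x) p))
                            (length-trans (reaches x) p)

  ≼-depth-≥⇒≡ : ∀ {x y} → x ≼ y → depth y ≤ depth x → y ≡ x
  ≼-depth-≥⇒≡ here _ = refl
  ≼-depth-≥⇒≡ {x} (up y≢r p) y≤x =
    ⊥-elim (<⇒≱ (s≤s (m≤n+m (depth x) (length p))) (subst (_≤ depth x) (depth-≼ (up y≢r p)) y≤x))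

  leaf-below : ∀ x → ∃[ ℓ ] (Leaf ℓ × x ≼ ℓ)
  leaf-below x
    with least-or-none (Flip.isTotalPreorder ≤-isTotalPreorder) depth (≼-dec x) (allFin nV)
  ... | inj₁ none = ⊥-elim (none (∈-allFin x) here)
  ... | inj₂ (m , x≼m , deepest) = m , leaf , x≼m
    where
      leaf : Leaf m
      leaf w w≢r refl = <⇒≱ (≤-reflexive (sym (depth-≼ (up w≢r here))))
                            (deepest (∈-allFin w) (≼-trans x≼m (up w≢r here)))

  module _ (branches : IsUnionOfBranchesAtRoot) where

    descendants-comparable : ∀ {v x y} → v ≢ root → v ≼ x → v ≼ y → x ≼ y ⊎ y ≼ x
    descendants-comparable {v} {x} {y} v≢r v≼x v≼y with leaf-below x | leaf-below y
    ... | ℓ , leafℓ , x≼ℓ | ℓ' , leafℓ' , y≼ℓ' with ℓ ≟ ℓ'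
    ...   | yes refl = ancestors-comparable x≼ℓ y≼ℓ'
    ...   | no ℓ≢ℓ' =
      ⊥-elim (v≢r (branches ℓ ℓ' leafℓ leafℓ' ℓ≢ℓ' v (≼-trans v≼x x≼ℓ) (≼-trans v≼y y≼ℓ')))

    depth-≤⇒≼ : ∀ {v x y} → v ≢ root → v ≼ x → v ≼ y → depth x ≤ depth y → x ≼ y
    depth-≤⇒≼ v≢r v≼x v≼y x≤y with descendants-comparable v≢r v≼x v≼y
    ... | inj₁ x≼y = x≼y
    ... | inj₂ y≼x = subst (_ ≼_) (≼-depth-≥⇒≡ y≼x x≤y) here

module AuxiliaryGraphProperties {G : Multigraph} (T : RootedSpanningTree G)
                                {j : ℕ} (vs : Fin j → Fin (Multigraph.nV G)) where
  open Multigraph G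
  open TreeNotions T
  open RootedSpanningTreeProperties T
  open HNotions T vs

  HAdj-sym : ∀ {e a b} → HAdj e a b → HAdj e b a
  HAdj-sym (inj₁ h) = inj₂ h
  HAdj-sym (inj₂ h) = inj₁ h

  HAdj-irrefl : ∀ {e a b} → HAdj e a b → a ≢ b
  HAdj-irrefl (inj₁ (_ , a≢b , _)) = a≢b
  HAdj-irrefl (inj₂ (_ , b≢a , _)) = b≢a ∘ sym

  Conn-mono : ∀ {A B : Fin nE → Set} → (∀ {e} → A e → B e) → ∀ {a b} → Conn A a b → Conn B a b
  Conn-mono A⊆B stay = stay
  Conn-mono A⊆B (step ae h path) = step (A⊆B ae) h (Conn-mono A⊆B path)

  Conn-snoc : ∀ {A : Fin nE → Set} {a b d e} → Conn A a b → A e → HAdj e b d → Conn A a d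
  Conn-snoc stay ae h = step ae h stay
  Conn-snoc (step ae' h' path) ae h = step ae' h' (Conn-snoc path ae h)

  Conn-preserves : ∀ {A : Fin nE → Set} (Q : Fin j → Set) →
    (∀ {e a b} → A e → HAdj e a b → Q a → Q b) → ∀ {a b} → Conn A a b → Q a → Q b
  Conn-preserves Q step-Q stay qa = qa
  Conn-preserves Q step-Q (step ae h path) qa = Conn-preserves Q step-Q path (step-Q ae h qa)

  -- The endpoint of e lying in T(v_b); end₂ e if there is none.
  endIn : Fin nE → Fin j → Fin nV
  endIn e b with ≼-dec (vs b) (end₁ e)
  ... | yes _ = end₁ e
  ... | no _ = end₂ e

  endIn-endpoint : ∀ e b → endIn e b ≡ end₁ e ⊎ endIn e b ≡ end₂ e
  endIn-endpoint e b with ≼-dec (vs b) (end₁ e)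
  ... | yes _ = inj₁ refl
  ... | no _ = inj₂ refl

  endIn-≼ : ∀ {e a b} → HAdj e a b → vs b ≼ endIn e b
  endIn-≼ {e} {b = b} h with ≼-dec (vs b) (end₁ e) | h
  ... | yes b≼e₁ | _ = b≼e₁
  ... | no _ | inj₁ (_ , _ , _ , b≼e₂) = b≼e₂
  ... | no b⋠e₁ | inj₂ (_ , _ , b≼e₁ , _) = ⊥-elim (b⋠e₁ b≼e₁)

  ≼-endIn⇒PartiallyPreceded : ∀ {u e b} → u ≼ endIn e b → PartiallyPreceded u e
  ≼-endIn⇒PartiallyPreceded {u} {e} {b} u≼end with endIn-endpoint e b
  ... | inj₁ eq = inj₁ (subst (u ≼_) eq u≼end)
  ... | inj₂ eq = inj₂ (subst (u ≼_) eq u≼end)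

  module _ (disjoint : ∀ {a b x} → vs a ≼ x → vs b ≼ x → a ≡ b) where

    disjoint-subtrees⇒InE' : ∀ {e a b} → a ≢ b → vs a ≼ end₁ e → vs b ≼ end₂ e → InE' e
    disjoint-subtrees⇒InE' a≢b a≼e₁ b≼e₂ (_ , bot , _ , (_ , e₁≼bot) , (_ , e₂≼bot)) =
      a≢b (disjoint (≼-trans a≼e₁ e₁≼bot) (≼-trans b≼e₂ e₂≼bot))

    HEdge? : ∀ e a b → Dec (HEdge e a b)
    HEdge? e a b =
      map′ (λ (a≢b , a≼e₁ , b≼e₂) → disjoint-subtrees⇒InE' a≢b a≼e₁ b≼e₂ , a≢b , a≼e₁ , b≼e₂) proj₂
           (¬? (a ≟ b) ×-dec ≼-dec (vs a) (end₁ e) ×-dec ≼-dec (vs b) (end₂ e))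

    HAdj? : ∀ e a b → Dec (HAdj e a b)
    HAdj? e a b = HEdge? e a b ⊎-dec HEdge? e b a

    HAdj-ends : ∀ {e a b x z} → HAdj e a b → HAdj e x z → (a ≡ x × b ≡ z) ⊎ (a ≡ z × b ≡ x)
    HAdj-ends (inj₁ (_ , _ , a₁ , b₂)) (inj₁ (_ , _ , x₁ , z₂)) =
      inj₁ (disjoint a₁ x₁ , disjoint b₂ z₂)
    HAdj-ends (inj₁ (_ , _ , a₁ , b₂)) (inj₂ (_ , _ , z₁ , x₂)) =
      inj₂ (disjoint a₁ z₁ , disjoint b₂ x₂)
    HAdj-ends (inj₂ (_ , _ , b₁ , a₂)) (inj₁ (_ , _ , x₁ , z₂)) =
      inj₂ (disjoint a₂ z₂ , disjoint b₁ x₁)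
    HAdj-ends (inj₂ (_ , _ , b₁ , a₂)) (inj₂ (_ , _ , z₁ , x₂)) =
      inj₁ (disjoint a₂ x₂ , disjoint b₁ z₁)

module GreedySpanningTree {G : Multigraph} (T : RootedSpanningTree G)
    (branches : TreeNotions.IsUnionOfBranchesAtRoot T)
    {j : ℕ} (vs : Fin j → Fin (Multigraph.nV G))
    (vs≢root : ∀ i → vs i ≢ RootedSpanningTree.root T)
    (disjoint : ∀ {a b x} → TreeNotions._≼_ T (vs a) x → TreeNotions._≼_ T (vs b) x → a ≡ b)
    (c : Fin j) where
  open Multigraph G
  open TreeNotions T
  open RootedSpanningTreeProperties T
  open HNotions T vs
  open AuxiliaryGraphProperties T vs

  record Invariant (S : Subset j) (TC : List (Fin nE)) : Set where
    field
      c∈S       : c ∈ₛ S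
      spans     : ∀ {i} → i ∈ₛ S → Conn (_∈ TC) c i
      inside    : ∀ {e a b} → e ∈ TC → HAdj e a b → a ∈ₛ S × b ∈ₛ S
      compEdges : ∀ {e} → e ∈ TC → CompEdge c e
      acyclic   : ∀ {f i i'} → f ∈ TC → HAdj f i i' → ¬ Conn (λ e → e ∈ TC × e ≢ f) i i'
      covers    : ∀ {e a b} → HAdj e a b → a ∈ₛ S → b ∈ₛ S → PrecededByEndpointOf TC e

  Crossing : Subset j → Fin nE × Fin j × Fin j → Set
  Crossing S (e , a , b) = HAdj e a b × a ∈ₛ S × b ∉ₛ S

  module Extend {S TC} (inv : Invariant S TC)
      {e x z} (h : HAdj e x z) (x∈S : x ∈ₛ S) (z∉S : z ∉ₛ S)
      (lightest : ∀ {e' a b} → Crossing S (e' , a , b) → depth (endIn e z) ≤ depth (endIn e' b))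
      where
    open Invariant inv

    S' : Subset j
    S' = S ∪ ⁅ z ⁆

    old : ∀ {i} → i ∈ₛ S → i ∈ₛ S'
    old i∈S = x∈p∪q⁺ (inj₁ i∈S)

    new : z ∈ₛ S'
    new = x∈p∪q⁺ (inj₂ (x∈⁅x⁆ z))

    old-or-new : ∀ {i} → i ∈ₛ S' → i ∈ₛ S ⊎ i ≡ z
    old-or-new i∈S' with x∈p∪q⁻ S ⁅ z ⁆ i∈S'
    ... | inj₁ i∈S = inj₁ i∈S
    ... | inj₂ i∈z = inj₂ (x∈⁅y⁆⇒x≡y z i∈z)

    ∈S⇒≢z : ∀ {i} → i ∈ₛ S → i ≢ z
    ∈S⇒≢z i∈S refl = z∉S i∈S

    spans' : ∀ {i} → i ∈ₛ S' → Conn (_∈ e ∷ TC) c i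
    spans' i∈S' with old-or-new i∈S'
    ... | inj₁ i∈S = Conn-mono there (spans i∈S)
    ... | inj₂ refl = Conn-snoc (Conn-mono there (spans x∈S)) (here refl) h

    inside' : ∀ {f a b} → f ∈ e ∷ TC → HAdj f a b → a ∈ₛ S' × b ∈ₛ S'
    inside' (here refl) hf with HAdj-ends disjoint hf h
    ... | inj₁ (refl , refl) = old x∈S , new
    ... | inj₂ (refl , refl) = new , old x∈S
    inside' (there f∈TC) hf = let a∈S , b∈S = inside f∈TC hf in old a∈S , old b∈S

    compEdges' : ∀ {f} → f ∈ e ∷ TC → CompEdge c f
    compEdges' (here refl) = x , z , h , Conn-mono (λ _ → tt) (spans x∈S)
    compEdges' (there f∈TC) = compEdges f∈TC

    -- Contracting e onto x turns a path avoiding f in e ∷ TC into one avoiding f in TC,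
    -- because no edge of TC touches z.
    contract : Fin j → Fin j
    contract a with a ≟ z
    ... | yes _ = x
    ... | no _ = a

    contract-S : ∀ {a} → a ∈ₛ S → contract a ≡ a
    contract-S {a} a∈S with a ≟ z
    ... | yes a≡z = ⊥-elim (∈S⇒≢z a∈S a≡z)
    ... | no _ = refl

    contract-z : contract z ≡ x
    contract-z with z ≟ z
    ... | yes _ = refl
    ... | no z≢z = ⊥-elim (z≢z refl)

    contract-e : ∀ {a b} → HAdj e a b → contract a ≡ contract b
    contract-e he with HAdj-ends disjoint he h
    ... | inj₁ (refl , refl) = trans (contract-S x∈S) (sym contract-z)
    ... | inj₂ (refl , refl) = trans contract-z (sym (contract-S x∈S))

    contract-Conn : ∀ {f a b} → Conn (λ g → g ∈ e ∷ TC × g ≢ f) a b →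
                    Conn (λ g → g ∈ TC × g ≢ f) (contract a) (contract b)
    contract-Conn stay = stay
    contract-Conn (step {g} (g∈ , g≢f) hg path) with g ≟ e | g∈
    ... | yes refl | _ = subst (λ a → Conn _ a _) (sym (contract-e hg)) (contract-Conn path)
    ... | no g≢e | here g≡e = ⊥-elim (g≢e g≡e)
    ... | no _ | there g∈TC =
      let a∈S , b∈S = inside g∈TC hg in
      step (g∈TC , g≢f) (subst₂ (HAdj g) (sym (contract-S a∈S)) (sym (contract-S b∈S)) hg)
           (contract-Conn path)

    old-edge : ∀ {g} → g ∈ e ∷ TC × g ≢ e → g ∈ TC
    old-edge (here refl , g≢e) = ⊥-elim (g≢e refl)
    old-edge (there g∈TC , _) = g∈TC

    avoiding-e-preserves-∈S : ∀ {a b} → Conn (λ g → g ∈ e ∷ TC × g ≢ e) a b → a ∈ₛ S → b ∈ₛ S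
    avoiding-e-preserves-∈S = Conn-preserves (_∈ₛ S) λ g hg _ → proj₂ (inside (old-edge g) hg)

    avoiding-e-preserves-∉S : ∀ {a b} → Conn (λ g → g ∈ e ∷ TC × g ≢ e) a b → a ∉ₛ S → b ∉ₛ S
    avoiding-e-preserves-∉S =
      Conn-preserves (_∉ₛ S) λ g hg a∉S → ⊥-elim (a∉S (proj₁ (inside (old-edge g) hg)))

    acyclic' : ∀ {f i i'} → f ∈ e ∷ TC → HAdj f i i' → ¬ Conn (λ g → g ∈ e ∷ TC × g ≢ f) i i'
    acyclic' (here refl) hf path with HAdj-ends disjoint hf h
    ... | inj₁ (refl , refl) = z∉S (avoiding-e-preserves-∈S path x∈S)
    ... | inj₂ (refl , refl) = avoiding-e-preserves-∉S path z∉S x∈S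
    acyclic' (there f∈TC) hf path =
      let i∈S , i'∈S = inside f∈TC hf in
      acyclic f∈TC hf (subst₂ (Conn _) (contract-S i∈S) (contract-S i'∈S) (contract-Conn path))

    covered-via-e : ∀ {g a} → HAdj g a z → a ∈ₛ S → PrecededByEndpointOf (e ∷ TC) g
    covered-via-e hg a∈S = e , here refl , endIn e z , endIn-endpoint e z ,
      ≼-endIn⇒PartiallyPreceded
        (depth-≤⇒≼ branches (vs≢root z) (endIn-≼ h) (endIn-≼ hg) (lightest (hg , a∈S , z∉S)))

    covers' : ∀ {g a b} → HAdj g a b → a ∈ₛ S' → b ∈ₛ S' → PrecededByEndpointOf (e ∷ TC) g
    covers' hg a∈S' b∈S' with old-or-new a∈S' | old-or-new b∈S'
    ... | inj₁ a∈S | inj₁ b∈S = let g' , g'∈ , rest = covers hg a∈S b∈S in g' , there g'∈ , rest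
    ... | inj₁ a∈S | inj₂ refl = covered-via-e hg a∈S
    ... | inj₂ refl | inj₁ b∈S = covered-via-e (HAdj-sym hg) b∈S
    ... | inj₂ refl | inj₂ refl = ⊥-elim (HAdj-irrefl hg refl)

    invariant : Invariant S' (e ∷ TC)
    invariant = record
      { c∈S = old c∈S ; spans = spans' ; inside = inside' ; compEdges = compEdges'
      ; acyclic = acyclic' ; covers = covers' }

  initial : Invariant ⁅ c ⁆ []
  initial = record
    { c∈S = x∈⁅x⁆ c
    ; spans = λ i∈c → subst (Conn _ c) (sym (x∈⁅y⁆⇒x≡y c i∈c)) stay
    ; inside = λ ()
    ; compEdges = λ ()
    ; acyclic = λ ()
    ; covers = λ hg a∈c b∈c →
        ⊥-elim (HAdj-irrefl hg (trans (x∈⁅y⁆⇒x≡y c a∈c) (sym (x∈⁅y⁆⇒x≡y c b∈c))))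
    }

  Closed : Subset j → Set
  Closed S = ∀ {e a b} → HAdj e a b → a ∈ₛ S → b ∈ₛ S

  triples : List (Fin nE × Fin j × Fin j)
  triples = cartesianProduct (allFin nE) (cartesianProduct (allFin j) (allFin j))

  ∈-triples : ∀ t → t ∈ triples
  ∈-triples (e , a , b) =
    ∈-cartesianProduct⁺ (∈-allFin e) (∈-cartesianProduct⁺ (∈-allFin a) (∈-allFin b))

  Crossing? : ∀ S → Decidable (Crossing S)
  Crossing? S (e , a , b) = HAdj? disjoint e a b ×-dec a ∈? S ×-dec ¬? (b ∈? S)

  grow : ∀ n {S TC} → Invariant S TC → j ≤ n + ∣ S ∣ →
         ∃[ S' ] ∃[ TC' ] (Invariant S' TC' × Closed S')
  grow n {S} {TC} inv j≤n+∣S∣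
    with least-or-none ≤-isTotalPreorder (λ (e , _ , b) → depth (endIn e b)) (Crossing? S) triples
  ... | inj₁ none =
    S , TC , inv , λ hab a∈S →
      decidable-stable (_ ∈? S) λ b∉S → none (∈-triples _) (hab , a∈S , b∉S)
  ... | inj₂ ((e , x , z) , (h , x∈S , z∉S) , lightest) with n
  ...   | zero = ⊥-elim (<⇒≱ (x∉p⇒∣p∣<n z∉S) j≤n+∣S∣)
  ...   | suc n' = grow n' (Extend.invariant inv h x∈S z∉S (lightest (∈-triples _)))
                    (≤-trans j≤n+∣S∣ fuel-suffices)
    where
      fuel-suffices : suc n' + ∣ S ∣ ≤ n' + ∣ S ∪ ⁅ z ⁆ ∣
      fuel-suffices =
        subst (_≤ n' + ∣ S ∪ ⁅ z ⁆ ∣) (+-suc n' ∣ S ∣) (+-monoʳ-≤ n' (x∉p⇒∣p∣<∣p∪⁅x⁆∣ z∉S))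

  spanning-tree : ∃[ TC ] (IsSpanningTreeOfComp c TC ×
                           (∀ e → CompEdge c e → PrecededByEndpointOf TC e))
  spanning-tree with grow j initial (m≤m+n j _)
  ... | S , TC , inv , closed =
    TC , ((λ _ → compEdges) , (λ _ → spans ∘ component⊆S) , λ _ f∈TC _ _ → acyclic f∈TC) ,
    λ _ (_ , _ , h , i∈C) → covers h (component⊆S i∈C) (closed h (component⊆S i∈C))
    where
      open Invariant inv
      component⊆S : ∀ {i} → InComp c i → i ∈ₛ S
      component⊆S i∈C = Conn-preserves (_∈ₛ S) (λ _ → closed) i∈C c∈S

lemma4p4 : (G : Multigraph) (T : RootedSpanningTree G) →
    TreeNotions.IsUnionOfBranchesAtRoot T →
    (j : ℕ) (part : Fin (Multigraph.nV G) → Fin (suc j)) →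
    CutNotions.IsMinKCut G (suc j) part →
    part (RootedSpanningTree.root T) ≡ fromℕ j →
    (vs : Fin j → Fin (Multigraph.nV G)) →
    (∀ i → vs i ≢ RootedSpanningTree.root T) →
    (∀ i i' → vs i ≡ vs i' → i ≡ i') →
    (∀ v → v ≢ RootedSpanningTree.root T →
      (part v ≢ part (RootedSpanningTree.parent T v) ⇔ (∃[ i ] v ≡ vs i))) →
    (∀ i i' → i ≢ i' →
      ¬ (∃[ ℓ ] (TreeNotions.Leaf T ℓ × TreeNotions._≼_ T (vs i) ℓ ×
                 TreeNotions._≼_ T (vs i') ℓ))) →
    (∀ i x → (part x ≡ inject₁ i ⇔ TreeNotions._≼_ T (vs i) x)) →
    ∀ (c : Fin j) → ∃[ TC ] (HNotions.IsSpanningTreeOfComp T vs c TC ×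
      (∀ e → HNotions.CompEdge T vs c e → HNotions.PrecededByEndpointOf T vs TC e))
lemma4p4 G T branches j part _ _ vs vs≢root _ _ _ parts c =
  GreedySpanningTree.spanning-tree T branches vs vs≢root disjoint c
  where
    open TreeNotions T
    disjoint : ∀ {a b x} → vs a ≼ x → vs b ≼ x → a ≡ b
    disjoint {a} {b} {x} a≼x b≼x =
      inject₁-injective (trans (sym (Equivalence.from (parts a x) a≼x))
                               (Equivalence.from (parts b x) b≼x))
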